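{- Let $m\ge n\ge 1$ and $0\le k\le n$ be integers, and let $(m-1)^k$ be the partition with $k$ parts equal to $m-1$, inside the $n\times m$ board. Then for every integer $r$, \[ H^{m,n}_r\big((m-1)^k\big)=\begin{cases} q^k[m-k]\,[m-1]_{n-1}, & r=k,\\ [k]\,[m-1]_{n-1}, & r=k-1,\\ 0, & \text{otherwise}.\end{cases} \]
   Context: $q$ is an indeterminate; $[x]=(1-q^x)/(1-q)$, $[n]_k=[n][n-1]\cdots[n-k+1]$ ($[n]_0=1$), $[n]!=[n]_n$, $(a;q)_k=\prod_{i=0}^{k-1}(1-aq^i)$. A partition $\lambda$ is identified with its Ferrers board (rows from the top, columns from the left, row $i$ having $\lambda_i$ cells); $|\lambda|$ is its number of cells; $\lambda$ is inside the $n\times m$ board if $\ell(\lambda)\le n$, $\lambda_1\le m$. $R_k(\lambda)=\sum_p q^{\mathrm{inv}(p)}$ over placements of $k$ non-attacking rooks on $\lambda$, with $\mathrm{inv}(p)$ the number of cells of $\lambda$ having no rook and neither to the left of a rook in the same row nor above a rook in the same column. For $m\ge n$ and $\lambda$ inside the $n\times m$ board, $H^{m,n}_i(\lambda)$ ($0\le i\le n$) are defined by $\sum_{i=0}^n H^{m,n}_i(\lambda)x^i=\frac{q^{ -|\lambda|}}{[m-n]!}\sum_{i=0}^n R_i(\lambda)[m-i]!(-1)^iq^{mi-\binom i2}(x;q)_i$, and $H^{m,n}_i(\lambda)=0$ for $i<0$ or $i>n$. -}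

module Defs where

open import Level using (Level)
open import Algebra.Bundles using (CommutativeRing)
open import Data.Nat as ℕ using (ℕ; zero; suc; _∸_; _<ᵇ_; _≡ᵇ_)
open import Data.Bool using (Bool; true; false; if_then_else_; _∧_; _∨_; not)
open import Data.Maybe using (Maybe; just; nothing)
open import Data.List using (List; []; _∷_; [_]; map; concatMap; upTo; length; replicate; _++_)
open import Data.Integer using (ℤ; +_; -[1+_])

-- A board λ inside the n×m board is given by its list of row lengths
-- λ₁, …, λₙ (rows from the top, padded with zeros to n rows).
-- A rook placement assigns to each row either no rook (nothing) or the
-- column (counted from 0 on the left) of its unique rook.

Board : Set
Board = List ℕ

Placement : Set
Placement = List (Maybe ℕ)

rowPlacements : Board → List Placement
rowPlacements []       = [ [] ]
rowPlacements (l ∷ ls) =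
  concatMap (λ p → map (λ c → c ∷ p) (nothing ∷ map just (upTo l))) (rowPlacements ls)

hasRook : ℕ → Placement → Bool
hasRook j []             = false
hasRook j (nothing ∷ p)  = hasRook j p
hasRook j (just c ∷ p)   = (c ≡ᵇ j) ∨ hasRook j p

-- no two rooks in the same column (rows are distinct by construction)
nonAttacking : Placement → Bool
nonAttacking []            = true
nonAttacking (nothing ∷ p) = nonAttacking p
nonAttacking (just c ∷ p)  = not (hasRook c p) ∧ nonAttacking p

rookCount : Placement → ℕ
rookCount []            = 0
rookCount (nothing ∷ p) = rookCount p
rookCount (just _ ∷ p)  = suc (rookCount p)

filterᵇ : {A : Set} → (A → Bool) → List A → List A
filterᵇ f []       = []
filterᵇ f (x ∷ xs) = if f x then x ∷ filterᵇ f xs else filterᵇ f xs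

rookPlacements : ℕ → Board → List Placement
rookPlacements k λ′ = filterᵇ (λ p → nonAttacking p ∧ (rookCount p ≡ᵇ k)) (rowPlacements λ′)

countᵇ : (ℕ → Bool) → ℕ → ℕ
countᵇ f zero    = 0
countᵇ f (suc j) = (if f j then 1 else 0) ℕ.+ countᵇ f j

-- inv(p): number of cells (i,j) of λ with no rook, not to the left of a
-- rook in row i, and not above a rook in column j.
inv : Board → Placement → ℕ
inv (l ∷ ls) (r ∷ rest) = countᵇ (λ j → rowOK r j ∧ not (hasRook j rest)) l ℕ.+ inv ls rest
  where
  rowOK : Maybe ℕ → ℕ → Bool
  rowOK nothing  j = true
  rowOK (just c) j = c <ᵇ j
inv _ _ = 0

size : Board → ℕ
size []       = 0
size (l ∷ ls) = l ℕ.+ size ls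

rectBoard : (n m k : ℕ) → Board
rectBoard n m k = replicate k (m ∸ 1) ++ replicate (n ∸ k) 0

-- q-arithmetic over an arbitrary commutative ring R, with q a unit of R
-- (qinv its inverse).  This covers the Laurent polynomial ring ℤ[q,q⁻¹].

module QCalc {c ℓ : Level} (R : CommutativeRing c ℓ) (q qinv : CommutativeRing.Carrier R) where
  open CommutativeRing R public

  pow : Carrier → ℕ → Carrier
  pow a zero    = 1#
  pow a (suc k) = a * pow a k

  -- [x] = (1 - q^x)/(1 - q) = 1 + q + … + q^(x-1)
  qint : ℕ → Carrier
  qint zero    = 0#
  qint (suc x) = 1# + q * qint x

  qfall : ℕ → ℕ → Carrier
  qfall n zero    = 1#
  qfall n (suc k) = qint n * qfall (n ∸ 1) k

  -- polynomials in x: coefficient lists, lowest degree first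
  Poly : Set c
  Poly = List Carrier

  _+ₚ_ : Poly → Poly → Poly
  []       +ₚ g        = g
  (a ∷ f)  +ₚ []       = a ∷ f
  (a ∷ f)  +ₚ (b ∷ g)  = (a + b) ∷ (f +ₚ g)

  scaleₚ : Carrier → Poly → Poly
  scaleₚ a = map (a *_)

  mulLin : Carrier → Poly → Poly
  mulLin a f = f +ₚ (0# ∷ scaleₚ (- a) f)

  xqPoch : ℕ → Poly
  xqPoch zero    = [ 1# ]
  xqPoch (suc i) = mulLin (pow q i) (xqPoch i)

  coeff : Poly → ℕ → Carrier
  coeff []      _       = 0#
  coeff (a ∷ f) zero    = a
  coeff (a ∷ f) (suc i) = coeff f i

  sumR : List Carrier → Carrier
  sumR []       = 0#
  sumR (a ∷ as) = a + sumR as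

  rookNum : ℕ → Board → Carrier
  rookNum k λ′ = sumR (map (λ p → pow q (inv λ′ p)) (rookPlacements k λ′))

  choose2 : ℕ → ℕ
  choose2 zero    = 0
  choose2 (suc i) = i ℕ.+ choose2 i

  -- term i of the sum, with [m-i]!/[m-n]! written as [m-i]_{n-i}
  hitTerm : (m n : ℕ) → Board → ℕ → Poly
  hitTerm m n λ′ i =
    scaleₚ (rookNum i λ′ * qfall (m ∸ i) (n ∸ i) * pow (- 1#) i
             * pow q ((m ℕ.* i) ∸ choose2 i))
           (xqPoch i)

  hitPolySum : (m n : ℕ) → Board → ℕ → Poly
  hitPolySum m n λ′ zero    = hitTerm m n λ′ 0
  hitPolySum m n λ′ (suc i) = hitTerm m n λ′ (suc i) +ₚ hitPolySum m n λ′ i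

  hitPoly : (m n : ℕ) → Board → Poly
  hitPoly m n λ′ = scaleₚ (pow qinv (size λ′)) (hitPolySum m n λ′ n)

  H : (m n : ℕ) → Board → ℤ → Carrier
  H m n λ′ -[1+ _ ] = 0#
  H m n λ′ (+ i)    = if n <ᵇ i then 0# else coeff (hitPoly m n λ′) i

-- Adding a top row of length l to a board whose rows have length at most l gives
-- R_i(l ∷ λ) = q^(l-i) R_i(λ) + [l-i+1] R_(i-1)(λ): left empty, the new row has l-i cells outside
-- the columns of the rooks below, all counted by inv; otherwise its rook has l-i+1 free columns to
-- choose from, and the free cells to its right sum to a q-integer.  Hence the rook numbers of
-- (m-1)^k are [m-1]_i ρ(k,i) for a q-Pascal array ρ.  In the i-th term of the hit polynomial the
-- remaining factors combine to [m-1]_(n-1) ρ(k,i) σ_i ([m] - [i]) (x;q)_i, where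
-- σ_i = ∏_(t<i) (-q^(m-1-t)).  The Pascal recursion of ρ and (x;q)_(i+1) = (x;q)_i (1 - q^i x)
-- then give Σ_i ρ(k,i) σ_i (x;q)_i = q^(k(m-1)) x^k and
-- Σ_i ρ(k,i) [i] σ_i (x;q)_i = q^(k(m-1)) [k] (x^k - x^(k-1)).  As |λ| = k(m-1) and
-- [m] - [k] = q^k [m-k], the hit polynomial is [m-1]_(n-1) (q^k [m-k] x^k + [k] x^(k-1)).
module Submission where

open import Defs
open import Algebra.Bundles using (CommutativeRing)
open import Data.Nat using (ℕ; zero; suc; _∸_; _≤_; _<_; z≤n; s≤s; _≡ᵇ_; _<ᵇ_)
import Data.Nat as ℕ
import Data.Nat.Properties as ℕ
open import Data.Integer using (ℤ; +_; -[1+_]) renaming (_-_ to _-ℤ_)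
open import Data.Bool using (Bool; true; false; not; _∧_; _∨_; if_then_else_)
open import Data.Maybe using (Maybe; just; nothing)
open import Data.List using (List; []; _∷_; [_]; _∷ʳ_; _++_; map; concatMap; upTo; replicate)
open import Data.List.Relation.Unary.All as All using (All; []; _∷_)
open import Data.Product using (_×_; _,_)
open import Function using (_∘_)
open import Relation.Binary.PropositionalEquality as ≡ using (_≡_; _≢_)

-- The library's ring solvers either need decidable equality of the carrier or cannot cancel
-- x - x; Algebra.Solver.Ring with integer coefficients works over every commutative ring once
-- ℤ is mapped into it.
module CommutativeRingSolver {c ℓ} (R : CommutativeRing c ℓ) where
  open import Data.Integer as ℤ using (_⊖_)
  import Data.Integer.Properties as ℤ
  open import Data.Sign as Sign using (Sign)
  open import Relation.Nullary using (yes; no)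
  import Algebra.Solver.Ring.AlmostCommutativeRing as ACR
  open CommutativeRing R
  open import Algebra.Properties.Ring ring using (-‿involutive; -0#≈0#; -‿distribˡ-*; -‿distribʳ-*)
  open import Algebra.Properties.AbelianGroup +-abelianGroup using (⁻¹-∙-comm)
  open import Algebra.Properties.Semiring.Mult.TCOptimised semiring using (1+×; ×-homo-+; ×1-homo-*)
    renaming (_×_ to _·_)
  open import Algebra.Properties.CommutativeSemigroup *-commutativeSemigroup using (interchange)
  open import Relation.Binary.Reasoning.Setoid setoid

  private
    fromℤ : ℤ → Carrier
    fromℤ (+ n)    = n · 1#
    fromℤ -[1+ n ] = - (suc n · 1#)

    ⊖-homo : ∀ m n → fromℤ (m ⊖ n) ≈ m · 1# - n · 1#
    ⊖-homo m zero = begin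
      fromℤ (m ⊖ 0)  ≡⟨ ≡.cong fromℤ (ℤ.⊖-≥ {m} z≤n) ⟩
      m · 1#         ≈⟨ sym (+-identityʳ _) ⟩
      m · 1# + 0#    ≈⟨ +-congˡ (sym -0#≈0#) ⟩
      m · 1# - 0#    ∎
    ⊖-homo zero    (suc n) = sym (+-identityˡ _)
    ⊖-homo (suc m) (suc n) = begin
      fromℤ (suc m ⊖ suc n)    ≡⟨ ≡.cong fromℤ (ℤ.[1+m]⊖[1+n]≡m⊖n m n) ⟩
      fromℤ (m ⊖ n)            ≈⟨ ⊖-homo m n ⟩
      M - N                    ≈⟨ +-congʳ (sym (+-identityʳ M)) ⟩
      (M + 0#) - N             ≈⟨ +-congʳ (+-congˡ (sym (-‿inverseʳ 1#))) ⟩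
      (M + (1# - 1#)) - N      ≈⟨ +-congʳ (sym (+-assoc M 1# (- 1#))) ⟩
      ((M + 1#) - 1#) - N      ≈⟨ +-congʳ (+-congʳ (+-comm M 1#)) ⟩
      ((1# + M) - 1#) - N      ≈⟨ +-assoc (1# + M) (- 1#) (- N) ⟩
      (1# + M) + (- 1# - N)    ≈⟨ +-congˡ (⁻¹-∙-comm 1# N) ⟩
      (1# + M) - (1# + N)      ≈⟨ +-cong (sym (1+× m 1#)) (-‿cong (sym (1+× n 1#))) ⟩
      suc m · 1# - suc n · 1#  ∎
      where
      M N : Carrier
      M = m · 1#
      N = n · 1#

    +-homo : ∀ i j → fromℤ (i ℤ.+ j) ≈ fromℤ i + fromℤ j
    +-homo -[1+ m ] -[1+ n ] = begin
      - (suc (suc (m ℕ.+ n)) · 1#)   ≡⟨ ≡.cong (λ t → - (t · 1#)) (≡.sym (ℕ.+-suc (suc m) n)) ⟩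
      - ((suc m ℕ.+ suc n) · 1#)     ≈⟨ -‿cong (×-homo-+ 1# (suc m) (suc n)) ⟩
      - (suc m · 1# + suc n · 1#)    ≈⟨ sym (⁻¹-∙-comm _ _) ⟩
      - (suc m · 1#) - (suc n · 1#)  ∎
    +-homo -[1+ m ] (+ n)    = trans (⊖-homo n (suc m)) (+-comm _ _)
    +-homo (+ m)    -[1+ n ] = ⊖-homo m (suc n)
    +-homo (+ m)    (+ n)    = ×-homo-+ 1# m n

    fromSign : Sign → Carrier
    fromSign Sign.+ = 1#
    fromSign Sign.- = - 1#

    fromSign-homo : ∀ s t → fromSign (s Sign.* t) ≈ fromSign s * fromSign t
    fromSign-homo Sign.- Sign.- = begin
      1#             ≈⟨ sym (-‿involutive 1#) ⟩
      - - 1#         ≈⟨ -‿cong (-‿cong (sym (*-identityʳ 1#))) ⟩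
      - - (1# * 1#)  ≈⟨ -‿cong (-‿distribˡ-* 1# 1#) ⟩
      - (- 1# * 1#)  ≈⟨ -‿distribʳ-* (- 1#) 1# ⟩
      - 1# * - 1#    ∎
    fromSign-homo Sign.- Sign.+ = sym (*-identityʳ _)
    fromSign-homo Sign.+ _      = sym (*-identityˡ _)

    ◃-homo : ∀ s n → fromℤ (s ℤ.◃ n) ≈ fromSign s * (n · 1#)
    ◃-homo s      zero    = sym (zeroʳ _)
    ◃-homo Sign.+ (suc n) = sym (*-identityˡ _)
    ◃-homo Sign.- (suc n) = trans (-‿cong (sym (*-identityˡ _))) (-‿distribˡ-* _ _)

    sign-abs : ∀ i → fromℤ i ≈ fromSign (ℤ.sign i) * (ℤ.∣ i ∣ · 1#)
    sign-abs (+ n)    = sym (*-identityˡ _)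
    sign-abs -[1+ n ] = ◃-homo Sign.- (suc n)

    *-homo : ∀ i j → fromℤ (i ℤ.* j) ≈ fromℤ i * fromℤ j
    *-homo i j = begin
      fromℤ ((s Sign.* t) ℤ.◃ (a ℕ.* b))            ≈⟨ ◃-homo (s Sign.* t) (a ℕ.* b) ⟩
      fromSign (s Sign.* t) * ((a ℕ.* b) · 1#)      ≈⟨ *-cong (fromSign-homo s t) (×1-homo-* a b) ⟩
      (fromSign s * fromSign t) * (a · 1# * b · 1#)  ≈⟨ interchange _ _ _ _ ⟩
      (fromSign s * a · 1#) * (fromSign t * b · 1#)  ≈⟨ sym (*-cong (sign-abs i) (sign-abs j)) ⟩
      fromℤ i * fromℤ j                              ∎
      where
      s t : Sign
      s = ℤ.sign i
      t = ℤ.sign j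
      a b : ℕ
      a = ℤ.∣ i ∣
      b = ℤ.∣ j ∣

    -‿homo : ∀ i → fromℤ (ℤ.- i) ≈ - fromℤ i
    -‿homo -[1+ n ]  = sym (-‿involutive _)
    -‿homo (+ zero)  = sym -0#≈0#
    -‿homo (+ suc n) = refl

    homomorphism : ℤ.+-*-rawRing ACR.-Raw-AlmostCommutative⟶ ACR.fromCommutativeRing R
    homomorphism = record
      { ⟦_⟧    = fromℤ
      ; +-homo = +-homo
      ; *-homo = *-homo
      ; -‿homo = -‿homo
      ; 0-homo = refl
      ; 1-homo = refl
      }

    fromℤ-≟ : ∀ i j → Maybe (fromℤ i ≈ fromℤ j)
    fromℤ-≟ i j with i ℤ.≟ j
    ... | yes i≡j = just (reflexive (≡.cong fromℤ i≡j))
    ... | no _    = nothing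

  open import Algebra.Solver.Ring ℤ.+-*-rawRing (ACR.fromCommutativeRing R) homomorphism fromℤ-≟ public
    using (Polynomial; solve; _:=_; _:+_; _:*_; _:-_; :-_; con)

  :0 :1 : ∀ {n} → Polynomial n
  :0 = con (+ 0)
  :1 = con (+ 1)

module Counting where
  open import Data.Nat using (_+_)
  open import Data.Bool.Properties using (T-≡)
  open import Function.Bundles using (Equivalence)
  import Data.Maybe.Relation.Unary.All as Maybe
  open import Data.List.Relation.Unary.All.Properties using (map⁺; concat⁺; all-upTo)
  open import Data.Sum using (inj₁; inj₂)
  open import Data.Empty using (⊥-elim)
  open ≡ using (refl; cong; sym; trans)

  ≡ᵇ≡true⇒≡ : ∀ {m n} → (m ≡ᵇ n) ≡ true → m ≡ n
  ≡ᵇ≡true⇒≡ {m} {n} = ℕ.≡ᵇ⇒≡ m n ∘ Equivalence.from T-≡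

  ≡ᵇ-refl : ∀ n → (n ≡ᵇ n) ≡ true
  ≡ᵇ-refl n = Equivalence.to T-≡ (ℕ.≡⇒≡ᵇ n n refl)

  ≢⇒≡ᵇ≡false : ∀ {m n} → m ≢ n → (m ≡ᵇ n) ≡ false
  ≢⇒≡ᵇ≡false {m} {n} m≢n with m ≡ᵇ n in eq
  ... | true  = ⊥-elim (m≢n (≡ᵇ≡true⇒≡ eq))
  ... | false = refl

  <⇒<ᵇ≡true : ∀ {m n} → m < n → (m <ᵇ n) ≡ true
  <⇒<ᵇ≡true = Equivalence.to T-≡ ∘ ℕ.<⇒<ᵇ

  <ᵇ≡true⇒< : ∀ {m n} → (m <ᵇ n) ≡ true → m < n
  <ᵇ≡true⇒< {m} {n} = ℕ.<ᵇ⇒< m n ∘ Equivalence.from T-≡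

  ≥⇒<ᵇ≡false : ∀ {m n} → n ≤ m → (m <ᵇ n) ≡ false
  ≥⇒<ᵇ≡false {m} {n} n≤m with m <ᵇ n in eq
  ... | true  = ⊥-elim (ℕ.<⇒≱ (<ᵇ≡true⇒< eq) n≤m)
  ... | false = refl

  countᵇ-cong : ∀ {f g : ℕ → Bool} n → (∀ {j} → j < n → f j ≡ g j) → countᵇ f n ≡ countᵇ g n
  countᵇ-cong zero    f≗g = refl
  countᵇ-cong (suc n) f≗g rewrite f≗g (ℕ.n<1+n n) =
    cong (_+_ _) (countᵇ-cong n (λ j<n → f≗g (ℕ.m<n⇒m<1+n j<n)))

  countᵇ-false : ∀ n → countᵇ (λ _ → false) n ≡ 0
  countᵇ-false zero    = refl
  countᵇ-false (suc n) = countᵇ-false n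

  countᵇ-not : ∀ (f : ℕ → Bool) n → countᵇ (λ j → not (f j)) n + countᵇ f n ≡ n
  countᵇ-not f zero    = refl
  countᵇ-not f (suc n) with f n
  ... | true  = trans (ℕ.+-suc _ _) (cong suc (countᵇ-not f n))
  ... | false = cong suc (countᵇ-not f n)

  countᵇ-insert : ∀ (f : ℕ → Bool) {a n} → f a ≡ false → a < n →
    countᵇ (λ j → (a ≡ᵇ j) ∨ f j) n ≡ suc (countᵇ f n)
  countᵇ-insert f {a} {suc n} fa≡false a<1+n with ℕ.m≤n⇒m<n∨m≡n (ℕ.≤-pred a<1+n)
  ... | inj₂ refl rewrite ≡ᵇ-refl a | fa≡false =
    cong suc (countᵇ-cong a (λ {j} j<a → cong (_∨ f j) (≢⇒≡ᵇ≡false (ℕ.>⇒≢ j<a))))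
  ... | inj₁ a<n rewrite ≢⇒≡ᵇ≡false (ℕ.<⇒≢ a<n) =
    trans (cong (_+_ _) (countᵇ-insert f fa≡false a<n)) (ℕ.+-suc _ _)

  countᵇ-above : ∀ (f : ℕ → Bool) {a n} → n ≤ a → countᵇ (λ j → (a <ᵇ j) ∧ f j) n ≡ 0
  countᵇ-above f {n = zero}  _   = refl
  countᵇ-above f {n = suc n} n<a rewrite ≥⇒<ᵇ≡false (ℕ.<⇒≤ n<a) = countᵇ-above f (ℕ.<⇒≤ n<a)

  RooksWithin : ℕ → Placement → Set
  RooksWithin w = All (Maybe.All (_< w))

  rowPlacements-within : ∀ {w ls} → All (_≤ w) ls → All (RooksWithin w) (rowPlacements ls)
  rowPlacements-within []                          = [] ∷ []
  rowPlacements-within {w} {l ∷ _} (l≤w ∷ ls≤w) =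
    concat⁺ (map⁺ (All.map extend (rowPlacements-within ls≤w)))
    where
    extend : ∀ {p} → RooksWithin w p → All (RooksWithin w) (map (_∷ p) (nothing ∷ map just (upTo l)))
    extend p-within = map⁺ ((Maybe.nothing ∷ p-within)
      ∷ map⁺ (All.map (λ a<l → Maybe.just (ℕ.<-≤-trans a<l l≤w) ∷ p-within) (all-upTo l)))

  countᵇ-hasRook : ∀ {w p} → RooksWithin w p → nonAttacking p ≡ true →
    countᵇ (λ j → hasRook j p) w ≡ rookCount p
  countᵇ-hasRook {w} []                       _  = countᵇ-false w
  countᵇ-hasRook (Maybe.nothing ∷ within)     na = countᵇ-hasRook within na
  countᵇ-hasRook {p = just a ∷ p} (Maybe.just a<w ∷ within) na with hasRook a p in a-free | na
  ... | false | na′ = trans (countᵇ-insert _ a-free a<w) (cong suc (countᵇ-hasRook within na′))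

  countᵇ-free : ∀ {w p} → RooksWithin w p → nonAttacking p ≡ true →
    countᵇ (λ j → not (hasRook j p)) w ≡ w ∸ rookCount p
  countᵇ-free {w} {p} within na = begin
    free
      ≡⟨ ℕ.m+n∸n≡m free (rookCount p) ⟨
    free + rookCount p ∸ rookCount p
      ≡⟨ cong (λ t → free + t ∸ rookCount p) (countᵇ-hasRook within na) ⟨
    free + countᵇ (λ j → hasRook j p) w ∸ rookCount p
      ≡⟨ cong (_∸ rookCount p) (countᵇ-not _ w) ⟩
    w ∸ rookCount p ∎
    where
    open ≡.≡-Reasoning
    free : ℕ
    free = countᵇ (λ j → not (hasRook j p)) w

  size-rectangle : ∀ w k z → size (replicate k w ++ replicate z 0) ≡ k ℕ.* w
  size-rectangle w zero    zero    = refl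
  size-rectangle w zero    (suc z) = size-rectangle w 0 z
  size-rectangle w (suc k) z       = cong (_+_ w) (size-rectangle w k z)

open Counting

module HitNumbers {c ℓ} (R : CommutativeRing c ℓ) (q qinv : CommutativeRing.Carrier R) where
  import Data.List.Properties as List
  open import Data.List.Relation.Unary.All.Properties using (all-upTo; replicate⁺; ++⁺)
  open import Data.Sum using (inj₁; inj₂)
  open QCalc R q qinv
  open CommutativeRingSolver R
  open import Algebra.Properties.Ring ring using (-‿distribˡ-*; -‿distribʳ-*; -0#≈0#)
  open import Algebra.Properties.CommutativeSemigroup *-commutativeSemigroup using (x∙yz≈y∙xz)
  open import Relation.Binary.Reasoning.Setoid setoid

  -- q-integers and q-falling factorials

  pow-+ : ∀ a i j → pow a (i ℕ.+ j) ≈ pow a i * pow a j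
  pow-+ a zero    j = sym (*-identityˡ _)
  pow-+ a (suc i) j = trans (*-congˡ (pow-+ a i j)) (sym (*-assoc _ _ _))

  pow-inverse : ∀ {a b} → a * b ≈ 1# → ∀ j → pow b j * pow a j ≈ 1#
  pow-inverse ab≈1 zero    = *-identityˡ 1#
  pow-inverse {a} {b} ab≈1 (suc j) = begin
    (b * pow b j) * (a * pow a j)
      ≈⟨ solve 4 (λ a b x y → (b :* x) :* (a :* y) := (a :* b) :* (x :* y)) refl a b (pow b j) (pow a j) ⟩
    (a * b) * (pow b j * pow a j)
      ≈⟨ *-cong ab≈1 (pow-inverse ab≈1 j) ⟩
    1# * 1#
      ≈⟨ *-identityˡ 1# ⟩
    1# ∎

  qint-suc : ∀ i → qint (suc i) ≈ qint i + pow q i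
  qint-suc zero    = solve 1 (λ q → :1 :+ q :* :0 := :0 :+ :1) refl q
  qint-suc (suc i) = begin
    1# + q * qint (suc i)
      ≈⟨ +-congˡ (*-congˡ (qint-suc i)) ⟩
    1# + q * (qint i + pow q i)
      ≈⟨ solve 3 (λ q a b → :1 :+ q :* (a :+ b) := (:1 :+ q :* a) :+ q :* b) refl q (qint i) (pow q i) ⟩
    (1# + q * qint i) + q * pow q i ∎

  qint-split : ∀ {k m} → k ≤ m → qint m ≈ qint k + pow q k * qint (m ∸ k)
  qint-split {zero} {m} _ = solve 1 (λ a → a := :0 :+ :1 :* a) refl (qint m)
  qint-split {suc k} {suc m} (s≤s k≤m) = begin
    1# + q * qint m
      ≈⟨ +-congˡ (*-congˡ (qint-split k≤m)) ⟩
    1# + q * (qint k + pow q k * qint (m ∸ k))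
      ≈⟨ solve 4 (λ q a b x → :1 :+ q :* (a :+ b :* x) := (:1 :+ q :* a) :+ (q :* b) :* x)
           refl q (qint k) (pow q k) (qint (m ∸ k)) ⟩
    (1# + q * qint k) + (q * pow q k) * qint (m ∸ k) ∎

  qfall-+ : ∀ a s t → qfall a (s ℕ.+ t) ≈ qfall a s * qfall (a ∸ s) t
  qfall-+ a zero    t = sym (*-identityˡ _)
  qfall-+ a (suc s) t = begin
    qint a * qfall (a ∸ 1) (s ℕ.+ t)
      ≈⟨ *-congˡ (qfall-+ (a ∸ 1) s t) ⟩
    qint a * (qfall (a ∸ 1) s * qfall (a ∸ 1 ∸ s) t)
      ≈⟨ sym (*-assoc _ _ _) ⟩
    (qint a * qfall (a ∸ 1) s) * qfall (a ∸ 1 ∸ s) t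
      ≡⟨ ≡.cong (λ b → (qint a * qfall (a ∸ 1) s) * qfall b t) (ℕ.∸-+-assoc a 1 s) ⟩
    (qint a * qfall (a ∸ 1) s) * qfall (a ∸ suc s) t ∎

  qfall-suc : ∀ a i → qfall a (suc i) ≈ qfall a i * qint (a ∸ i)
  qfall-suc a i = begin
    qfall a (suc i)                    ≡⟨ ≡.cong (qfall a) (ℕ.+-comm 1 i) ⟩
    qfall a (i ℕ.+ 1)                  ≈⟨ qfall-+ a i 1 ⟩
    qfall a i * (qint (a ∸ i) * 1#)    ≈⟨ *-congˡ (*-identityʳ _) ⟩
    qfall a i * qint (a ∸ i)           ∎

  -- [m-1]_i [m-i]_{n-i} = [m-1]_{n-1} [m-i], here with m = 1 + w and n = 1 + n′
  qfall-repeated-factor : ∀ {w n′ i} → n′ ≤ w → i ≤ suc n′ →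
    qfall w i * qfall (suc w ∸ i) (suc n′ ∸ i) ≈ qfall w n′ * qint (suc w ∸ i)
  qfall-repeated-factor {w} {n′} {i} n′≤w i≤1+n′ with ℕ.m≤n⇒m<n∨m≡n i≤1+n′
  ... | inj₂ ≡.refl = begin
    qfall w (suc n′) * qfall (w ∸ n′) (n′ ∸ n′)
      ≡⟨ ≡.cong (λ t → qfall w (suc n′) * qfall (w ∸ n′) t) (ℕ.n∸n≡0 n′) ⟩
    qfall w (suc n′) * 1#
      ≈⟨ *-identityʳ _ ⟩
    qfall w (suc n′)
      ≈⟨ qfall-suc w n′ ⟩
    qfall w n′ * qint (w ∸ n′) ∎
  ... | inj₁ (s≤s i≤n′) = begin
    qfall w i * qfall (suc w ∸ i) (suc n′ ∸ i)
      ≡⟨ ≡.cong₂ (λ a b → qfall w i * qfall a b) (ℕ.+-∸-assoc 1 i≤w) (ℕ.+-∸-assoc 1 i≤n′) ⟩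
    qfall w i * (qint (suc (w ∸ i)) * qfall (w ∸ i) (n′ ∸ i))
      ≈⟨ solve 3 (λ a b x → a :* (b :* x) := (a :* x) :* b)
           refl (qfall w i) (qint (suc (w ∸ i))) (qfall (w ∸ i) (n′ ∸ i)) ⟩
    (qfall w i * qfall (w ∸ i) (n′ ∸ i)) * qint (suc (w ∸ i))
      ≈⟨ *-congʳ (sym (qfall-+ w i (n′ ∸ i))) ⟩
    qfall w (i ℕ.+ (n′ ∸ i)) * qint (suc (w ∸ i))
      ≡⟨ ≡.cong₂ (λ a b → qfall w a * qint b) (ℕ.m+[n∸m]≡n i≤n′) (≡.sym (ℕ.+-∸-assoc 1 i≤w)) ⟩
    qfall w n′ * qint (suc w ∸ i) ∎
    where
    i≤w : i ≤ w
    i≤w = ℕ.≤-trans i≤n′ n′≤w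

  -- Finite sums

  ∑ : {A : Set} → List A → (A → Carrier) → Carrier
  ∑ xs f = sumR (map f xs)

  -- looser than _+_ and _*_: the body of ∑[ i < n ] extends as far to the right as possible
  infix 5 ∑ ∑<

  syntax ∑ xs (λ x → e) = ∑[ x ← xs ] e

  ∑< : ℕ → (ℕ → Carrier) → Carrier
  ∑< n = ∑ (upTo n)

  syntax ∑< n (λ i → e) = ∑[ i < n ] e

  module _ {A : Set} where

    ∑-cong : ∀ {P : A → Set} {f g : A → Carrier} {xs} → All P xs → (∀ {x} → P x → f x ≈ g x) →
      ∑ xs f ≈ ∑ xs g
    ∑-cong []         f≈g = refl
    ∑-cong (px ∷ pxs) f≈g = +-cong (f≈g px) (∑-cong pxs f≈g)

    ∑-cong-≗ : ∀ {f g : A → Carrier} xs → (∀ x → f x ≈ g x) → ∑ xs f ≈ ∑ xs g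
    ∑-cong-≗ []       f≈g = refl
    ∑-cong-≗ (x ∷ xs) f≈g = +-cong (f≈g x) (∑-cong-≗ xs f≈g)

    ∑-zero : ∀ (xs : List A) → ∑[ x ← xs ] 0# ≈ 0#
    ∑-zero []       = refl
    ∑-zero (x ∷ xs) = trans (+-identityˡ _) (∑-zero xs)

    ∑-+ : ∀ (f g : A → Carrier) xs → ∑[ x ← xs ] (f x + g x) ≈ ∑ xs f + ∑ xs g
    ∑-+ f g []       = sym (+-identityˡ 0#)
    ∑-+ f g (x ∷ xs) = trans (+-congˡ (∑-+ f g xs))
      (solve 4 (λ a b c d → (a :+ b) :+ (c :+ d) := (a :+ c) :+ (b :+ d)) refl _ _ _ _)

    ∑-*ˡ : ∀ a (f : A → Carrier) xs → ∑[ x ← xs ] (a * f x) ≈ a * ∑ xs f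
    ∑-*ˡ a f []       = sym (zeroʳ a)
    ∑-*ˡ a f (x ∷ xs) = trans (+-congˡ (∑-*ˡ a f xs)) (sym (distribˡ a _ _))

    ∑-*ʳ : ∀ a (f : A → Carrier) xs → ∑[ x ← xs ] (f x * a) ≈ ∑ xs f * a
    ∑-*ʳ a f []       = sym (zeroˡ a)
    ∑-*ʳ a f (x ∷ xs) = trans (+-congˡ (∑-*ʳ a f xs)) (sym (distribʳ a _ _))

    ∑-neg : ∀ (f : A → Carrier) xs → ∑[ x ← xs ] (- f x) ≈ - ∑ xs f
    ∑-neg f []       = solve 0 (:0 := :- :0) refl
    ∑-neg f (x ∷ xs) = trans (+-congˡ (∑-neg f xs)) (solve 2 (λ a b → :- a :+ :- b := :- (a :+ b)) refl _ _)

    ∑-++ : ∀ (f : A → Carrier) xs ys → ∑ (xs ++ ys) f ≈ ∑ xs f + ∑ ys f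
    ∑-++ f []       ys = sym (+-identityˡ _)
    ∑-++ f (x ∷ xs) ys = trans (+-congˡ (∑-++ f xs ys)) (sym (+-assoc _ _ _))

    ∑-concatMap : ∀ {B : Set} (f : A → Carrier) (g : B → List A) ys →
      ∑ (concatMap g ys) f ≈ ∑[ y ← ys ] ∑ (g y) f
    ∑-concatMap f g []       = refl
    ∑-concatMap f g (y ∷ ys) = trans (∑-++ f (g y) (concatMap g ys)) (+-congˡ (∑-concatMap f g ys))

    ∑-map : ∀ {B : Set} (f : A → Carrier) (g : B → A) ys → ∑ (map g ys) f ≈ ∑[ y ← ys ] f (g y)
    ∑-map f g ys = reflexive (≡.cong sumR (≡.sym (List.map-∘ ys)))

    ∑-filterᵇ : ∀ (f : A → Carrier) (b : A → Bool) xs →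
      ∑ (filterᵇ b xs) f ≈ ∑[ x ← xs ] (if b x then f x else 0#)
    ∑-filterᵇ f b []       = refl
    ∑-filterᵇ f b (x ∷ xs) with b x
    ... | true  = +-congˡ (∑-filterᵇ f b xs)
    ... | false = trans (∑-filterᵇ f b xs) (sym (+-identityˡ _))

  ∑<-cong : ∀ {f g : ℕ → Carrier} n → (∀ {i} → i < n → f i ≈ g i) → ∑< n f ≈ ∑< n g
  ∑<-cong n = ∑-cong (all-upTo n)

  ∑<-last : ∀ (f : ℕ → Carrier) n → ∑[ i < suc n ] f i ≈ (∑[ i < n ] f i) + f n
  ∑<-last f n = begin
    ∑ (upTo (suc n)) f        ≡⟨ ≡.cong (λ xs → ∑ xs f) (List.upTo-∷ʳ n) ⟨
    ∑ (upTo n ∷ʳ n) f         ≈⟨ ∑-++ f (upTo n) [ n ] ⟩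
    ∑< n f + (f n + 0#)       ≈⟨ +-congˡ (+-identityʳ _) ⟩
    ∑< n f + f n              ∎

  ∑<-head : ∀ (f : ℕ → Carrier) n → ∑[ i < suc n ] f i ≈ f 0 + (∑[ i < n ] f (suc i))
  ∑<-head f n = +-congˡ (reflexive (≡.cong sumR
    (≡.trans (List.map-applyUpTo suc f n) (≡.sym (List.map-upTo (λ i → f (suc i)) n)))))

  ∑<-extend : ∀ (f : ℕ → Carrier) {n N} → n ≤ N → (∀ {i} → n ≤ i → f i ≈ 0#) → ∑< N f ≈ ∑< n f
  ∑<-extend f {N = zero}  z≤n f≈0 = refl
  ∑<-extend f {n} {suc N} n≤1+N f≈0 with ℕ.m≤n⇒m<n∨m≡n n≤1+N
  ... | inj₂ ≡.refl = refl
  ... | inj₁ n<1+N  = begin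
    ∑< (suc N) f   ≈⟨ ∑<-last f N ⟩
    ∑< N f + f N   ≈⟨ +-cong (∑<-extend f (ℕ.≤-pred n<1+N) f≈0) (f≈0 (ℕ.≤-pred n<1+N)) ⟩
    ∑< n f + 0#    ≈⟨ +-identityʳ _ ⟩
    ∑< n f         ∎

  -- Rook numbers

  qint-countᵇ : ∀ (f : ℕ → Bool) n →
    ∑[ a < n ] (if f a then pow q (countᵇ (λ j → (a <ᵇ j) ∧ f j) n) else 0#) ≈ qint (countᵇ f n)
  qint-countᵇ f zero    = refl
  qint-countᵇ f (suc n) = begin
    ∑< (suc n) (term (suc n))              ≈⟨ ∑<-last (term (suc n)) n ⟩
    ∑< n (term (suc n)) + term (suc n) n   ≈⟨ +-cong (∑<-cong n term-step) term-last ⟩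
    (∑[ a < n ] qIf * term n a) + oneIf    ≈⟨ +-congʳ (trans (∑-*ˡ qIf (term n) (upTo n)) (*-congˡ (qint-countᵇ f n))) ⟩
    qIf * qint (countᵇ f n) + oneIf        ≈⟨ qint-step (f n) ⟩
    qint (countᵇ f (suc n))                ∎
    where
    term : ℕ → ℕ → Carrier
    term n a = if f a then pow q (countᵇ (λ j → (a <ᵇ j) ∧ f j) n) else 0#
    qIf oneIf : Carrier
    qIf   = if f n then q else 1#
    oneIf = if f n then 1# else 0#

    term-step : ∀ {a} → a < n → term (suc n) a ≈ qIf * term n a
    term-step {a} a<n rewrite <⇒<ᵇ≡true a<n with f n | f a
    ... | true  | true  = refl
    ... | false | true  = sym (*-identityˡ _)
    ... | _     | false = sym (zeroʳ _)

    term-last : term (suc n) n ≈ oneIf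
    term-last rewrite ≥⇒<ᵇ≡false (ℕ.≤-refl {n}) | countᵇ-above f (ℕ.≤-refl {n}) with f n
    ... | true  = refl
    ... | false = refl

    qint-step : ∀ b → (if b then q else 1#) * qint (countᵇ f n) + (if b then 1# else 0#)
                      ≈ qint ((if b then 1 else 0) ℕ.+ countᵇ f n)
    qint-step true  = +-comm _ _
    qint-step false = trans (+-identityʳ _) (*-identityˡ _)

  rookWeight : ℕ → Board → Placement → Carrier
  rookWeight i λ′ p = if nonAttacking p ∧ (rookCount p ≡ᵇ i) then pow q (inv λ′ p) else 0#

  rookNum-∑ : ∀ i λ′ → rookNum i λ′ ≈ ∑[ p ← rowPlacements λ′ ] rookWeight i λ′ p
  rookNum-∑ i λ′ = ∑-filterᵇ _ _ (rowPlacements λ′)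

  -- on the support of rookWeight i, a placement leaves l ∸ i of the first l columns free
  rookWeight-free-columns : ∀ {l p} (g : ℕ → Carrier) i λ′ → RooksWithin l p →
    g (countᵇ (λ j → not (hasRook j p)) l) * rookWeight i λ′ p ≈ g (l ∸ i) * rookWeight i λ′ p
  rookWeight-free-columns {l} {p} g i λ′ within with nonAttacking p in na | rookCount p ≡ᵇ i in count≡i
  ... | false | _     = trans (zeroʳ _) (sym (zeroʳ _))
  ... | true  | false = trans (zeroʳ _) (sym (zeroʳ _))
  ... | true  | true  =
    *-congʳ (reflexive (≡.cong g (≡.trans (countᵇ-free within na)
                                          (≡.cong (l ∸_) (≡ᵇ≡true⇒≡ {rookCount p} count≡i)))))

  rookWeight-∷-nothing : ∀ i l λ′ p →
    rookWeight i (l ∷ λ′) (nothing ∷ p) ≈ pow q (countᵇ (λ j → not (hasRook j p)) l) * rookWeight i λ′ p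
  rookWeight-∷-nothing i l λ′ p with nonAttacking p ∧ (rookCount p ≡ᵇ i)
  ... | true  = pow-+ q (countᵇ (λ j → not (hasRook j p)) l) (inv λ′ p)
  ... | false = sym (zeroʳ _)

  rookWeight-zero-∷-just : ∀ a l λ′ p → rookWeight 0 (l ∷ λ′) (just a ∷ p) ≈ 0#
  rookWeight-zero-∷-just a l λ′ p with not (hasRook a p) ∧ nonAttacking p
  ... | true  = refl
  ... | false = refl

  rookWeight-suc-∷-just : ∀ i a l λ′ p →
    rookWeight (suc i) (l ∷ λ′) (just a ∷ p) ≈
    (if not (hasRook a p) then pow q (countᵇ (λ j → (a <ᵇ j) ∧ not (hasRook j p)) l) else 0#) * rookWeight i λ′ p
  rookWeight-suc-∷-just i a l λ′ p with hasRook a p | nonAttacking p | rookCount p ≡ᵇ i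
  ... | true  | _     | _     = sym (zeroˡ _)
  ... | false | false | _     = sym (zeroʳ _)
  ... | false | true  | false = sym (zeroʳ _)
  ... | false | true  | true  = pow-+ q (countᵇ (λ j → (a <ᵇ j) ∧ not (hasRook j p)) l) (inv λ′ p)

  extensionWeight : ℕ → ℕ → Board → Placement → Carrier
  extensionWeight i l λ′ p =
    rookWeight i (l ∷ λ′) (nothing ∷ p) + (∑[ a < l ] rookWeight i (l ∷ λ′) (just a ∷ p))

  rookNum-∷ : ∀ i l λ′ → rookNum i (l ∷ λ′) ≈ ∑[ p ← rowPlacements λ′ ] extensionWeight i l λ′ p
  rookNum-∷ i l λ′ = begin
    rookNum i (l ∷ λ′)
      ≈⟨ rookNum-∑ i (l ∷ λ′) ⟩
    ∑ (concatMap extensions (rowPlacements λ′)) (rookWeight i (l ∷ λ′))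
      ≈⟨ ∑-concatMap _ extensions (rowPlacements λ′) ⟩
    ∑[ p ← rowPlacements λ′ ] ∑ (extensions p) (rookWeight i (l ∷ λ′))
      ≈⟨ ∑-cong-≗ (rowPlacements λ′) (λ p →
           +-congˡ (trans (∑-map _ (_∷ p) (map just (upTo l))) (∑-map _ just (upTo l)))) ⟩
    ∑[ p ← rowPlacements λ′ ] extensionWeight i l λ′ p ∎
    where
    extensions : Placement → List Placement
    extensions p = map (_∷ p) (nothing ∷ map just (upTo l))

  extensionWeight-zero : ∀ {l p} λ′ → RooksWithin l p → extensionWeight 0 l λ′ p ≈ pow q l * rookWeight 0 λ′ p
  extensionWeight-zero {l} {p} λ′ within = begin
    extensionWeight 0 l λ′ p
      ≈⟨ +-cong (rookWeight-∷-nothing 0 l λ′ p)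
                (trans (∑-cong-≗ (upTo l) (λ a → rookWeight-zero-∷-just a l λ′ p)) (∑-zero (upTo l))) ⟩
    pow q (countᵇ (λ j → not (hasRook j p)) l) * rookWeight 0 λ′ p + 0#
      ≈⟨ trans (+-identityʳ _) (rookWeight-free-columns (pow q) 0 λ′ within) ⟩
    pow q l * rookWeight 0 λ′ p ∎

  extensionWeight-suc : ∀ {l p} i λ′ → RooksWithin l p →
    extensionWeight (suc i) l λ′ p ≈ pow q (l ∸ suc i) * rookWeight (suc i) λ′ p + qint (l ∸ i) * rookWeight i λ′ p
  extensionWeight-suc {l} {p} i λ′ within = +-cong
    (trans (rookWeight-∷-nothing (suc i) l λ′ p) (rookWeight-free-columns (pow q) (suc i) λ′ within))
    (begin
      ∑[ a < l ] rookWeight (suc i) (l ∷ λ′) (just a ∷ p)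
        ≈⟨ trans (∑-cong-≗ (upTo l) (λ a → rookWeight-suc-∷-just i a l λ′ p)) (∑-*ʳ _ _ (upTo l)) ⟩
      (∑[ a < l ] (if not (hasRook a p) then pow q (countᵇ (λ j → (a <ᵇ j) ∧ not (hasRook j p)) l) else 0#))
        * rookWeight i λ′ p
        ≈⟨ *-congʳ (qint-countᵇ (λ j → not (hasRook j p)) l) ⟩
      qint (countᵇ (λ j → not (hasRook j p)) l) * rookWeight i λ′ p
        ≈⟨ rookWeight-free-columns qint i λ′ within ⟩
      qint (l ∸ i) * rookWeight i λ′ p ∎)

  rookNum-zero-∷ : ∀ {l λ′} → All (_≤ l) λ′ → rookNum 0 (l ∷ λ′) ≈ pow q l * rookNum 0 λ′
  rookNum-zero-∷ {l} {λ′} λ′≤l = begin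
    rookNum 0 (l ∷ λ′)
      ≈⟨ rookNum-∷ 0 l λ′ ⟩
    ∑[ p ← rowPlacements λ′ ] extensionWeight 0 l λ′ p
      ≈⟨ ∑-cong (rowPlacements-within λ′≤l) (extensionWeight-zero λ′) ⟩
    ∑[ p ← rowPlacements λ′ ] pow q l * rookWeight 0 λ′ p
      ≈⟨ ∑-*ˡ _ _ (rowPlacements λ′) ⟩
    pow q l * (∑[ p ← rowPlacements λ′ ] rookWeight 0 λ′ p)
      ≈⟨ *-congˡ (sym (rookNum-∑ 0 λ′)) ⟩
    pow q l * rookNum 0 λ′ ∎

  rookNum-suc-∷ : ∀ {i l λ′} → All (_≤ l) λ′ →
    rookNum (suc i) (l ∷ λ′) ≈ pow q (l ∸ suc i) * rookNum (suc i) λ′ + qint (l ∸ i) * rookNum i λ′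
  rookNum-suc-∷ {i} {l} {λ′} λ′≤l = begin
    rookNum (suc i) (l ∷ λ′)
      ≈⟨ rookNum-∷ (suc i) l λ′ ⟩
    ∑[ p ← rowPlacements λ′ ] extensionWeight (suc i) l λ′ p
      ≈⟨ ∑-cong (rowPlacements-within λ′≤l) (extensionWeight-suc i λ′) ⟩
    ∑[ p ← rowPlacements λ′ ] (pow q (l ∸ suc i) * rookWeight (suc i) λ′ p + qint (l ∸ i) * rookWeight i λ′ p)
      ≈⟨ ∑-+ _ _ (rowPlacements λ′) ⟩
    (∑[ p ← rowPlacements λ′ ] pow q (l ∸ suc i) * rookWeight (suc i) λ′ p)
      + (∑[ p ← rowPlacements λ′ ] qint (l ∸ i) * rookWeight i λ′ p)
      ≈⟨ +-cong (trans (∑-*ˡ _ _ (rowPlacements λ′)) (*-congˡ (sym (rookNum-∑ (suc i) λ′))))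
                (trans (∑-*ˡ _ _ (rowPlacements λ′)) (*-congˡ (sym (rookNum-∑ i λ′)))) ⟩
    pow q (l ∸ suc i) * rookNum (suc i) λ′ + qint (l ∸ i) * rookNum i λ′ ∎

  rookNum-emptyRow : ∀ {λ′} → All (_≤ 0) λ′ → ∀ i → rookNum i (0 ∷ λ′) ≈ rookNum i λ′
  rookNum-emptyRow {λ′} λ′≤0 zero    = trans (rookNum-zero-∷ λ′≤0) (*-identityˡ _)
  rookNum-emptyRow {λ′} λ′≤0 (suc i) = begin
    rookNum (suc i) (0 ∷ λ′)
      ≈⟨ rookNum-suc-∷ λ′≤0 ⟩
    pow q (0 ∸ suc i) * rookNum (suc i) λ′ + qint (0 ∸ i) * rookNum i λ′
      ≡⟨ ≡.cong₂ (λ a b → pow q a * rookNum (suc i) λ′ + qint b * rookNum i λ′)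
                 (ℕ.0∸n≡0 (suc i)) (ℕ.0∸n≡0 i) ⟩
    1# * rookNum (suc i) λ′ + 0# * rookNum i λ′
      ≈⟨ solve 2 (λ a b → :1 :* a :+ :0 :* b := a) refl _ _ ⟩
    rookNum (suc i) λ′ ∎

  -- Coefficients of the hit polynomial

  timesX : (ℕ → Carrier) → ℕ → Carrier
  timesX f zero    = 0#
  timesX f (suc r) = f r

  *-timesX : ∀ a (f : ℕ → Carrier) r → a * timesX f r ≈ timesX (λ r′ → a * f r′) r
  *-timesX a f zero    = zeroʳ a
  *-timesX a f (suc r) = refl

  monomial : ℕ → ℕ → Carrier
  monomial k r = if r ≡ᵇ k then 1# else 0#

  monomial-diagonal : ∀ k → monomial k k ≈ 1#
  monomial-diagonal k = reflexive (≡.cong (if_then 1# else 0#) (≡ᵇ-refl k))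

  monomial-off : ∀ {k r} → r ≢ k → monomial k r ≈ 0#
  monomial-off r≢k = reflexive (≡.cong (if_then 1# else 0#) (≢⇒≡ᵇ≡false r≢k))

  coeff-+ₚ : ∀ f g r → coeff (f +ₚ g) r ≈ coeff f r + coeff g r
  coeff-+ₚ []      g       r       = sym (+-identityˡ _)
  coeff-+ₚ (a ∷ f) []      r       = sym (+-identityʳ _)
  coeff-+ₚ (a ∷ f) (b ∷ g) zero    = refl
  coeff-+ₚ (a ∷ f) (b ∷ g) (suc r) = coeff-+ₚ f g r

  coeff-scaleₚ : ∀ a f r → coeff (scaleₚ a f) r ≈ a * coeff f r
  coeff-scaleₚ a []      r       = sym (zeroʳ a)
  coeff-scaleₚ a (b ∷ f) zero    = refl
  coeff-scaleₚ a (b ∷ f) (suc r) = coeff-scaleₚ a f r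

  pochCoeff : ℕ → ℕ → Carrier
  pochCoeff i = coeff (xqPoch i)

  pochCoeff-suc : ∀ i r → pochCoeff (suc i) r ≈ pochCoeff i r - pow q i * timesX (pochCoeff i) r
  pochCoeff-suc i zero    = begin
    coeff (xqPoch i +ₚ (0# ∷ scaleₚ (- pow q i) (xqPoch i))) 0
      ≈⟨ coeff-+ₚ (xqPoch i) _ 0 ⟩
    pochCoeff i 0 + 0#
      ≈⟨ solve 2 (λ p b → p :+ :0 := p :- b :* :0) refl (pochCoeff i 0) (pow q i) ⟩
    pochCoeff i 0 - pow q i * 0# ∎
  pochCoeff-suc i (suc r) = begin
    coeff (xqPoch i +ₚ (0# ∷ scaleₚ (- pow q i) (xqPoch i))) (suc r)
      ≈⟨ coeff-+ₚ (xqPoch i) _ (suc r) ⟩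
    pochCoeff i (suc r) + coeff (scaleₚ (- pow q i) (xqPoch i)) r
      ≈⟨ +-congˡ (coeff-scaleₚ (- pow q i) (xqPoch i) r) ⟩
    pochCoeff i (suc r) + - pow q i * pochCoeff i r
      ≈⟨ +-congˡ (sym (-‿distribˡ-* _ _)) ⟩
    pochCoeff i (suc r) - pow q i * pochCoeff i r ∎

  coeff-hitPoly : ∀ m n λ′ r →
    coeff (hitPoly m n λ′) r ≈ pow qinv (size λ′) * (∑[ i < suc n ] coeff (hitTerm m n λ′ i) r)
  coeff-hitPoly m n λ′ r = trans (coeff-scaleₚ _ (hitPolySum m n λ′ n) r) (*-congˡ (coeff-hitPolySum n))
    where
    coeff-hitPolySum : ∀ N → coeff (hitPolySum m n λ′ N) r ≈ ∑[ i < suc N ] coeff (hitTerm m n λ′ i) r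
    coeff-hitPolySum zero    = sym (+-identityʳ _)
    coeff-hitPolySum (suc N) = begin
      coeff (hitTerm m n λ′ (suc N) +ₚ hitPolySum m n λ′ N) r
        ≈⟨ coeff-+ₚ (hitTerm m n λ′ (suc N)) _ r ⟩
      coeff (hitTerm m n λ′ (suc N)) r + coeff (hitPolySum m n λ′ N) r
        ≈⟨ trans (+-comm _ _) (+-congʳ (coeff-hitPolySum N)) ⟩
      (∑[ i < suc N ] coeff (hitTerm m n λ′ i) r) + coeff (hitTerm m n λ′ (suc N)) r
        ≈⟨ sym (∑<-last _ (suc N)) ⟩
      ∑[ i < suc (suc N) ] coeff (hitTerm m n λ′ i) r ∎

  choose2≤* : ∀ {m i} → i ≤ m → choose2 i ≤ m ℕ.* i
  choose2≤* {m} {zero}  _   = z≤n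
  choose2≤* {m} {suc i} i<m = ≡.subst (choose2 (suc i) ≤_) (≡.sym (ℕ.*-suc m i))
    (ℕ.+-mono-≤ (ℕ.<⇒≤ i<m) (choose2≤* (ℕ.<⇒≤ i<m)))

  *∸choose2-suc : ∀ {m i} → suc i ≤ m → m ℕ.* suc i ∸ choose2 (suc i) ≡ (m ∸ i) ℕ.+ (m ℕ.* i ∸ choose2 i)
  *∸choose2-suc {m} {i} i<m =
    ≡.trans (≡.cong (_∸ (i ℕ.+ choose2 i)) (ℕ.*-suc m i)) (≡.trans
    (≡.sym (ℕ.∸-+-assoc (m ℕ.+ m ℕ.* i) i (choose2 i))) (≡.trans
    (≡.cong (_∸ choose2 i) (ℕ.+-∸-comm (m ℕ.* i) (ℕ.<⇒≤ i<m)))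
    (ℕ.+-∸-assoc (m ∸ i) (choose2≤* (ℕ.<⇒≤ i<m)))))

  -- The board (m-1)^k, with w = m - 1

  module Rectangle (w : ℕ) where

    -- ρ k i = q^((k-i)(w-i)) [k choose i]; only its Pascal-type recursion is used
    ρ : ℕ → ℕ → Carrier
    ρ zero    zero    = 1#
    ρ zero    (suc i) = 0#
    ρ (suc k) zero    = pow q w * ρ k 0
    ρ (suc k) (suc i) = pow q (w ∸ suc i) * ρ k (suc i) + ρ k i

    ρ-vanishes : ∀ {k i} → k < i → ρ k i ≈ 0#
    ρ-vanishes {zero}  {suc i} _         = refl
    ρ-vanishes {suc k} {suc i} (s≤s k<i) = begin
      pow q (w ∸ suc i) * ρ k (suc i) + ρ k i  ≈⟨ +-cong (*-congˡ (ρ-vanishes (ℕ.m<n⇒m<1+n k<i))) (ρ-vanishes k<i) ⟩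
      pow q (w ∸ suc i) * 0# + 0#              ≈⟨ trans (+-identityʳ _) (zeroʳ _) ⟩
      0#                                       ∎

    rookNum-emptyRows : ∀ z i → rookNum i (replicate z 0) ≈ qfall w i * ρ 0 i
    rookNum-emptyRows zero    zero    = trans (+-identityʳ 1#) (sym (*-identityˡ 1#))
    rookNum-emptyRows zero    (suc i) = sym (zeroʳ _)
    rookNum-emptyRows (suc z) i       = trans (rookNum-emptyRow (replicate⁺ z z≤n) i) (rookNum-emptyRows z i)

    rectangleRows≤ : ∀ k z → All (_≤ w) (replicate k w ++ replicate z 0)
    rectangleRows≤ k z = ++⁺ (replicate⁺ k ℕ.≤-refl) (replicate⁺ z z≤n)

    rookNum-rectangle : ∀ k z i → rookNum i (replicate k w ++ replicate z 0) ≈ qfall w i * ρ k i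
    rookNum-rectangle zero    z i       = rookNum-emptyRows z i
    rookNum-rectangle (suc k) z zero    = begin
      rookNum 0 (w ∷ rows)              ≈⟨ rookNum-zero-∷ (rectangleRows≤ k z) ⟩
      pow q w * rookNum 0 rows          ≈⟨ *-congˡ (rookNum-rectangle k z 0) ⟩
      pow q w * (1# * ρ k 0)            ≈⟨ solve 2 (λ x r → x :* (:1 :* r) := :1 :* (x :* r)) refl (pow q w) (ρ k 0) ⟩
      1# * (pow q w * ρ k 0)            ∎
      where
      rows : Board
      rows = replicate k w ++ replicate z 0
    rookNum-rectangle (suc k) z (suc i) = begin
      rookNum (suc i) (w ∷ rows)
        ≈⟨ rookNum-suc-∷ (rectangleRows≤ k z) ⟩
      pow q (w ∸ suc i) * rookNum (suc i) rows + qint (w ∸ i) * rookNum i rows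
        ≈⟨ +-cong (*-congˡ (rookNum-rectangle k z (suc i))) (*-congˡ (rookNum-rectangle k z i)) ⟩
      pow q (w ∸ suc i) * (qfall w (suc i) * ρ k (suc i)) + qint (w ∸ i) * (qfall w i * ρ k i)
        ≈⟨ +-congʳ (*-congˡ (*-congʳ (qfall-suc w i))) ⟩
      pow q (w ∸ suc i) * ((qfall w i * qint (w ∸ i)) * ρ k (suc i)) + qint (w ∸ i) * (qfall w i * ρ k i)
        ≈⟨ solve 5 (λ x f t a b → x :* ((f :* t) :* a) :+ t :* (f :* b) := (f :* t) :* (x :* a :+ b)) refl
             (pow q (w ∸ suc i)) (qfall w i) (qint (w ∸ i)) (ρ k (suc i)) (ρ k i) ⟩
      (qfall w i * qint (w ∸ i)) * ρ (suc k) (suc i)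
        ≈⟨ *-congʳ (sym (qfall-suc w i)) ⟩
      qfall w (suc i) * ρ (suc k) (suc i) ∎
      where
      rows : Board
      rows = replicate k w ++ replicate z 0

    ∑ρ : ℕ → (ℕ → Carrier) → Carrier
    ∑ρ k a = ∑[ i < suc k ] ρ k i * a i

    ∑ρ-cong : ∀ k {a b : ℕ → Carrier} → (∀ {i} → i ≤ k → a i ≈ b i) → ∑ρ k a ≈ ∑ρ k b
    ∑ρ-cong k a≈b = ∑<-cong (suc k) (λ i<1+k → *-congˡ (a≈b (ℕ.≤-pred i<1+k)))

    ∑ρ-*ˡ : ∀ k x (a : ℕ → Carrier) → ∑ρ k (λ i → x * a i) ≈ x * ∑ρ k a
    ∑ρ-*ˡ k x a = trans (∑-cong-≗ (upTo (suc k)) (λ i → x∙yz≈y∙xz _ _ _)) (∑-*ˡ x _ (upTo (suc k)))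

    ∑ρ-+ : ∀ k (a b : ℕ → Carrier) → ∑ρ k (λ i → a i + b i) ≈ ∑ρ k a + ∑ρ k b
    ∑ρ-+ k a b = trans (∑-cong-≗ (upTo (suc k)) (λ i → distribˡ _ _ _)) (∑-+ _ _ (upTo (suc k)))

    ∑ρ-neg : ∀ k (a : ℕ → Carrier) → ∑ρ k (λ i → - a i) ≈ - ∑ρ k a
    ∑ρ-neg k a = trans (∑-cong-≗ (upTo (suc k)) (λ i → sym (-‿distribʳ-* _ _))) (∑-neg _ (upTo (suc k)))

    ∑ρ-timesX : ∀ k (a : ℕ → ℕ → Carrier) r →
      ∑ρ k (λ i → timesX (a i) r) ≈ timesX (λ r′ → ∑ρ k (λ i → a i r′)) r
    ∑ρ-timesX k a zero    = trans (∑-cong-≗ (upTo (suc k)) (λ i → zeroʳ _)) (∑-zero (upTo (suc k)))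
    ∑ρ-timesX k a (suc r) = refl

    ∑ρ-extend : ∀ {k N} (a : ℕ → Carrier) → k ≤ N → ∑[ i < suc N ] ρ k i * a i ≈ ∑ρ k a
    ∑ρ-extend a k≤N = ∑<-extend _ (s≤s k≤N) (λ k<i → trans (*-congʳ (ρ-vanishes k<i)) (zeroˡ _))

    ∑ρ-suc : ∀ k (a : ℕ → Carrier) → ∑ρ (suc k) a ≈ ∑ρ k (λ i → pow q (w ∸ i) * a i + a (suc i))
    ∑ρ-suc k a = begin
      ∑ρ (suc k) a
        ≈⟨ ∑<-head _ (suc k) ⟩
      ρ (suc k) 0 * a 0 + (∑[ i < suc k ] ρ (suc k) (suc i) * a (suc i))
        ≈⟨ +-cong (swap _ _ _) (∑-cong-≗ (upTo (suc k)) (λ i → trans (distribʳ _ _ _) (+-congʳ (swap _ _ _)))) ⟩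
      A 0 + (∑[ i < suc k ] A (suc i) + B i)
        ≈⟨ +-congˡ (∑-+ (λ i → A (suc i)) B (upTo (suc k))) ⟩
      A 0 + ((∑[ i < suc k ] A (suc i)) + ∑< (suc k) B)
        ≈⟨ trans (sym (+-assoc _ _ _)) (+-congʳ (sym (∑<-head A (suc k)))) ⟩
      ∑< (suc (suc k)) A + ∑< (suc k) B
        ≈⟨ +-congʳ (∑<-extend A (ℕ.n≤1+n (suc k)) (λ 1+k≤i → trans (*-congʳ (ρ-vanishes 1+k≤i)) (zeroˡ _))) ⟩
      ∑< (suc k) A + ∑< (suc k) B
        ≈⟨ trans (sym (∑-+ A B (upTo (suc k)))) (∑-cong-≗ (upTo (suc k)) (λ i → sym (distribˡ _ _ _))) ⟩
      ∑ρ k (λ i → pow q (w ∸ i) * a i + a (suc i)) ∎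
      where
      A B : ℕ → Carrier
      A i = ρ k i * (pow q (w ∸ i) * a i)
      B i = ρ k i * a (suc i)
      swap : ∀ x y z → (x * y) * z ≈ y * (x * z)
      swap x y z = trans (*-assoc x y z) (x∙yz≈y∙xz x y z)

    σ : ℕ → Carrier
    σ zero    = 1#
    σ (suc i) = - pow q (w ∸ i) * σ i

    q^[w∸i]*q^i : ∀ {i} → i ≤ w → pow q (w ∸ i) * pow q i ≈ pow q w
    q^[w∸i]*q^i {i} i≤w = trans (sym (pow-+ q (w ∸ i) i)) (reflexive (≡.cong (pow q) (ℕ.m∸n+n≡m i≤w)))

    sign-power : ∀ {i} → i ≤ suc w → pow (- 1#) i * pow q (suc w ℕ.* i ∸ choose2 i) ≈ pow q i * σ i
    sign-power {zero}  _ = *-congˡ (reflexive (≡.cong (pow q) (ℕ.*-zeroʳ (suc w))))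
    sign-power {suc i} (s≤s i≤w) = begin
      (- 1# * A) * pow q (suc w ℕ.* suc i ∸ choose2 (suc i))
        ≡⟨ ≡.cong (λ e → (- 1# * A) * pow q e)
                  (≡.trans (*∸choose2-suc (s≤s i≤w)) (≡.cong (ℕ._+ E) (ℕ.+-∸-assoc 1 i≤w))) ⟩
      (- 1# * A) * pow q (suc (w ∸ i) ℕ.+ E)
        ≈⟨ *-congˡ (pow-+ q (suc (w ∸ i)) E) ⟩
      (- 1# * A) * ((q * pow q (w ∸ i)) * pow q E)
        ≈⟨ solve 4 (λ a x q e → (:- :1 :* a) :* ((q :* x) :* e) := (:- (q :* x)) :* (a :* e))
             refl A (pow q (w ∸ i)) q (pow q E) ⟩
      (- (q * pow q (w ∸ i))) * (A * pow q E)
        ≈⟨ *-congˡ (sign-power (ℕ.m≤n⇒m≤1+n i≤w)) ⟩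
      (- (q * pow q (w ∸ i))) * (pow q i * σ i)
        ≈⟨ solve 4 (λ x q b s → (:- (q :* x)) :* (b :* s) := (q :* b) :* (:- x :* s))
             refl (pow q (w ∸ i)) q (pow q i) (σ i) ⟩
      pow q (suc i) * σ (suc i) ∎
      where
      A : Carrier
      A = pow (- 1#) i
      E : ℕ
      E = suc w ℕ.* i ∸ choose2 i

    V W : ℕ → ℕ → Carrier
    V k r = ∑ρ k (λ i → σ i * pochCoeff i r)
    W k r = ∑ρ k (λ i → qint i * (σ i * pochCoeff i r))

    V-step : ∀ {k} → k ≤ w → ∀ r → V (suc k) r ≈ pow q w * timesX (V k) r
    V-step {k} k≤w r = begin
      V (suc k) r
        ≈⟨ ∑ρ-suc k _ ⟩
      ∑ρ k (λ i → pow q (w ∸ i) * (σ i * P i) + σ (suc i) * pochCoeff (suc i) r)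
        ≈⟨ ∑ρ-cong k (λ i≤k → summand (ℕ.≤-trans i≤k k≤w)) ⟩
      ∑ρ k (λ i → pow q w * timesX (λ r′ → σ i * pochCoeff i r′) r)
        ≈⟨ trans (∑ρ-*ˡ k (pow q w) _) (*-congˡ (∑ρ-timesX k _ r)) ⟩
      pow q w * timesX (V k) r ∎
      where
      P : ℕ → Carrier
      P i = pochCoeff i r
      summand : ∀ {i} → i ≤ w →
        pow q (w ∸ i) * (σ i * P i) + σ (suc i) * pochCoeff (suc i) r ≈ pow q w * timesX (λ r′ → σ i * pochCoeff i r′) r
      summand {i} i≤w = begin
        pow q (w ∸ i) * (σ i * P i) + (- pow q (w ∸ i) * σ i) * pochCoeff (suc i) r
          ≈⟨ +-congˡ (*-congˡ (pochCoeff-suc i r)) ⟩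
        pow q (w ∸ i) * (σ i * P i) + (- pow q (w ∸ i) * σ i) * (P i - pow q i * timesX (pochCoeff i) r)
          ≈⟨ solve 5 (λ x s p b p′ → x :* (s :* p) :+ (:- x :* s) :* (p :- b :* p′) := (x :* b) :* (s :* p′)) refl
               (pow q (w ∸ i)) (σ i) (P i) (pow q i) (timesX (pochCoeff i) r) ⟩
        (pow q (w ∸ i) * pow q i) * (σ i * timesX (pochCoeff i) r)
          ≈⟨ *-cong (q^[w∸i]*q^i i≤w) (*-timesX (σ i) (pochCoeff i) r) ⟩
        pow q w * timesX (λ r′ → σ i * pochCoeff i r′) r ∎

    V-closed : ∀ {k} → k ≤ suc w → ∀ r → V k r ≈ pow q (k ℕ.* w) * monomial k r
    timesX-V : ∀ {k} → k ≤ w → ∀ r → timesX (V k) r ≈ pow q (k ℕ.* w) * monomial (suc k) r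
    V-closed {zero}  _ zero    = solve 0 (:1 :* (:1 :* :1) :+ :0 := :1 :* :1) refl
    V-closed {zero}  _ (suc r) = solve 0 (:1 :* (:1 :* :0) :+ :0 := :1 :* :0) refl
    V-closed {suc k} (s≤s k≤w) r = begin
      V (suc k) r                                           ≈⟨ V-step k≤w r ⟩
      pow q w * timesX (V k) r                              ≈⟨ *-congˡ (timesX-V k≤w r) ⟩
      pow q w * (pow q (k ℕ.* w) * monomial (suc k) r)      ≈⟨ sym (*-assoc _ _ _) ⟩
      (pow q w * pow q (k ℕ.* w)) * monomial (suc k) r      ≈⟨ *-congʳ (sym (pow-+ q w (k ℕ.* w))) ⟩
      pow q (suc k ℕ.* w) * monomial (suc k) r              ∎

    timesX-V k≤w zero    = sym (zeroʳ _)
    timesX-V k≤w (suc r) = V-closed (ℕ.m≤n⇒m≤1+n k≤w) r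

    W-step : ∀ {k} → k ≤ w → ∀ r → W (suc k) r ≈ pow q w * ((timesX (V k) r + q * timesX (W k) r) - V k r)
    W-step {k} k≤w r = begin
      W (suc k) r
        ≈⟨ ∑ρ-suc k _ ⟩
      ∑ρ k (λ i → pow q (w ∸ i) * (qint i * (σ i * P i)) + qint (suc i) * (σ (suc i) * pochCoeff (suc i) r))
        ≈⟨ ∑ρ-cong k (λ i≤k → summand (ℕ.≤-trans i≤k k≤w)) ⟩
      ∑ρ k (λ i → pow q w * ((timesX (λ r′ → σ i * pochCoeff i r′) r
                              + q * timesX (λ r′ → qint i * (σ i * pochCoeff i r′)) r) - σ i * P i))
        ≈⟨ ∑ρ-*ˡ k (pow q w) _ ⟩
      pow q w * ∑ρ k (λ i → (timesX (λ r′ → σ i * pochCoeff i r′) r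
                              + q * timesX (λ r′ → qint i * (σ i * pochCoeff i r′)) r) - σ i * P i)
        ≈⟨ *-congˡ (trans (∑ρ-+ k _ _) (+-cong (∑ρ-+ k _ _) (∑ρ-neg k _))) ⟩
      pow q w * ((∑ρ k (λ i → timesX (λ r′ → σ i * pochCoeff i r′) r)
                  + ∑ρ k (λ i → q * timesX (λ r′ → qint i * (σ i * pochCoeff i r′)) r)) - V k r)
        ≈⟨ *-congˡ (+-congʳ (+-cong (∑ρ-timesX k _ r) (trans (∑ρ-*ˡ k q _) (*-congˡ (∑ρ-timesX k _ r))))) ⟩
      pow q w * ((timesX (V k) r + q * timesX (W k) r) - V k r) ∎
      where
      P : ℕ → Carrier
      P i = pochCoeff i r
      summand : ∀ {i} → i ≤ w →
        pow q (w ∸ i) * (qint i * (σ i * P i)) + qint (suc i) * (σ (suc i) * pochCoeff (suc i) r) ≈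
        pow q w * ((timesX (λ r′ → σ i * pochCoeff i r′) r + q * timesX (λ r′ → qint i * (σ i * pochCoeff i r′)) r) - σ i * P i)
      summand {i} i≤w = begin
        x * (t * (s * P i)) + (1# + q * t) * ((- x * s) * pochCoeff (suc i) r)
          ≈⟨ +-congˡ (*-congˡ (*-congˡ (pochCoeff-suc i r))) ⟩
        x * (t * (s * P i)) + (1# + q * t) * ((- x * s) * (P i - b * p′))
          -- a polynomial identity, up to a multiple of [i] + q^i - [i+1], which vanishes
          ≈⟨ solve 7 (λ x t s p b p′ q →
                 x :* (t :* (s :* p)) :+ (:1 :+ q :* t) :* ((:- x :* s) :* (p :- b :* p′))
              := (x :* b) :* ((s :* p′ :+ q :* (t :* (s :* p′))) :- s :* p) :+ (x :* s :* p) :* ((t :+ b) :- (:1 :+ q :* t)))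
              refl x t s (P i) b p′ q ⟩
        (x * b) * ((s * p′ + q * (t * (s * p′))) - s * P i) + (x * s * P i) * ((t + b) - qint (suc i))
          ≈⟨ +-cong (*-cong (q^[w∸i]*q^i i≤w) (+-congʳ (+-cong s*p′ (*-congˡ (trans (*-congˡ s*p′) (*-timesX t _ r))))))
                    (trans (*-congˡ (trans (+-congʳ (sym (qint-suc i))) (-‿inverseʳ _))) (zeroʳ _)) ⟩
        pow q w * ((timesX (λ r′ → s * pochCoeff i r′) r + q * timesX (λ r′ → t * (s * pochCoeff i r′)) r) - s * P i) + 0#
          ≈⟨ +-identityʳ _ ⟩
        pow q w * ((timesX (λ r′ → s * pochCoeff i r′) r + q * timesX (λ r′ → t * (s * pochCoeff i r′)) r) - s * P i) ∎
        where
        x t s b p′ : Carrier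
        x  = pow q (w ∸ i)
        t  = qint i
        s  = σ i
        b  = pow q i
        p′ = timesX (pochCoeff i) r
        s*p′ : s * p′ ≈ timesX (λ r′ → s * pochCoeff i r′) r
        s*p′ = *-timesX s (pochCoeff i) r

    qint-monomial-zero : ∀ k → qint k * monomial k 0 ≈ 0#
    qint-monomial-zero zero    = zeroˡ _
    qint-monomial-zero (suc k) = zeroʳ _

    W-closed : ∀ {k} → k ≤ suc w → ∀ r →
      W k r ≈ pow q (k ℕ.* w) * (qint k * (monomial k r - monomial k (suc r)))
    W-closed {zero} _ r =
      solve 3 (λ p d e → :1 :* (:0 :* (:1 :* p)) :+ :0 := :1 :* (:0 :* (d :- e)))
           refl (pochCoeff 0 r) (monomial 0 r) (monomial 0 (suc r))
    W-closed {suc k} (s≤s k≤w) r = begin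
      W (suc k) r
        ≈⟨ W-step k≤w r ⟩
      pw * ((timesX (V k) r + q * timesX (W k) r) - V k r)
        ≈⟨ *-congˡ (+-cong (+-cong (timesX-V k≤w r) (*-congˡ (timesX-W r))) (-‿cong (V-closed k≤1+w r))) ⟩
      pw * ((pk * δ₁ + q * (pk * (qint k * (δ₁ - δ₀)))) - pk * δ₀)
        ≈⟨ solve 6 (λ pw pk δ₁ δ₀ q t →
               pw :* ((pk :* δ₁ :+ q :* (pk :* (t :* (δ₁ :- δ₀)))) :- pk :* δ₀)
            := (pw :* pk) :* ((:1 :+ q :* t) :* (δ₁ :- δ₀))) refl pw pk δ₁ δ₀ q (qint k) ⟩
      (pw * pk) * (qint (suc k) * (δ₁ - δ₀))
        ≈⟨ *-congʳ (sym (pow-+ q w (k ℕ.* w))) ⟩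
      pow q (suc k ℕ.* w) * (qint (suc k) * (monomial (suc k) r - monomial (suc k) (suc r))) ∎
      where
      pw pk δ₀ δ₁ : Carrier
      pw = pow q w
      pk = pow q (k ℕ.* w)
      δ₀ = monomial k r
      δ₁ = monomial (suc k) r
      k≤1+w : k ≤ suc w
      k≤1+w = ℕ.m≤n⇒m≤1+n k≤w
      timesX-W : ∀ r → timesX (W k) r ≈ pk * (qint k * (monomial (suc k) r - monomial k r))
      timesX-W (suc r) = W-closed k≤1+w r
      timesX-W zero    = sym (begin
        pk * (qint k * (0# - monomial k 0))
          ≈⟨ *-congˡ (solve 2 (λ t d → t :* (:0 :- d) := :- (t :* d)) refl (qint k) (monomial k 0)) ⟩
        pk * - (qint k * monomial k 0)
          ≈⟨ *-congˡ (trans (-‿cong (qint-monomial-zero k)) -0#≈0#) ⟩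
        pk * 0#
          ≈⟨ zeroʳ pk ⟩
        0# ∎)

    module HitPolynomial (q*qinv≈1 : q * qinv ≈ 1#) {n′ : ℕ} (n′≤w : n′ ≤ w) where

      board : ℕ → Board
      board = rectBoard (suc n′) (suc w)

      coeff-hitTerm : ∀ k {i} → i ≤ suc n′ → ∀ r →
        coeff (hitTerm (suc w) (suc n′) (board k) i) r ≈
        ρ k i * (qfall w n′ * (qint (suc w) * (σ i * pochCoeff i r) - qint i * (σ i * pochCoeff i r)))
      coeff-hitTerm k {i} i≤n r = begin
        coeff (hitTerm (suc w) (suc n′) (board k) i) r
          ≈⟨ coeff-scaleₚ _ (xqPoch i) r ⟩
        (rookNum i (board k) * fall * sgn * e) * P
          ≈⟨ *-congʳ (*-congʳ (*-congʳ (*-congʳ (rookNum-rectangle k (suc n′ ∸ k) i)))) ⟩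
        ((qfall w i * ρ k i) * fall * sgn * e) * P
          ≈⟨ solve 6 (λ f ρ g s e P → ((f :* ρ) :* g :* s :* e) :* P := ρ :* ((f :* g) :* (s :* e) :* P))
               refl (qfall w i) (ρ k i) fall sgn e P ⟩
        ρ k i * ((qfall w i * fall) * (sgn * e) * P)
          ≈⟨ *-congˡ (*-congʳ (*-cong (qfall-repeated-factor n′≤w i≤n) (sign-power i≤m))) ⟩
        ρ k i * ((qfall w n′ * qint (suc w ∸ i)) * (pow q i * σ i) * P)
          ≈⟨ *-congˡ (solve 6 (λ F t b s P K → (F :* t) :* (b :* s) :* P := F :* ((K :+ b :* t) :* (s :* P) :- K :* (s :* P))) refl
               (qfall w n′) (qint (suc w ∸ i)) (pow q i) (σ i) P (qint i)) ⟩
        ρ k i * (qfall w n′ * ((qint i + pow q i * qint (suc w ∸ i)) * (σ i * P) - qint i * (σ i * P)))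
          ≈⟨ *-congˡ (*-congˡ (+-congʳ (*-congʳ (sym (qint-split i≤m))))) ⟩
        ρ k i * (qfall w n′ * (qint (suc w) * (σ i * P) - qint i * (σ i * P))) ∎
        where
        i≤m : i ≤ suc w
        i≤m = ℕ.≤-trans i≤n (s≤s n′≤w)
        fall sgn e P : Carrier
        fall = qfall (suc w ∸ i) (suc n′ ∸ i)
        sgn  = pow (- 1#) i
        e    = pow q (suc w ℕ.* i ∸ choose2 i)
        P    = pochCoeff i r

      coeff-hitPoly-rectangle : ∀ {k} → k ≤ suc n′ → ∀ r →
        coeff (hitPoly (suc w) (suc n′) (board k)) r ≈
        qfall w n′ * (pow q k * qint (suc w ∸ k) * monomial k r + qint k * monomial k (suc r))
      coeff-hitPoly-rectangle {k} k≤n r = begin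
        coeff (hitPoly (suc w) (suc n′) (board k)) r
          ≈⟨ coeff-hitPoly (suc w) (suc n′) (board k) r ⟩
        pow qinv (size (board k)) * (∑[ i < suc (suc n′) ] coeff (hitTerm (suc w) (suc n′) (board k) i) r)
          ≈⟨ *-congˡ (∑<-cong (suc (suc n′)) (λ i<n → coeff-hitTerm k (ℕ.≤-pred i<n) r)) ⟩
        pow qinv (size (board k)) * (∑[ i < suc (suc n′) ] ρ k i * (F * (M * v i - qint i * v i)))
          ≈⟨ *-congˡ (∑ρ-extend _ k≤n) ⟩
        pow qinv (size (board k)) * ∑ρ k (λ i → F * (M * v i - qint i * v i))
          ≈⟨ *-congˡ (trans (∑ρ-*ˡ k F _) (*-congˡ (trans (∑ρ-+ k _ _) (+-cong (∑ρ-*ˡ k M v) (∑ρ-neg k _))))) ⟩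
        pow qinv (size (board k)) * (F * (M * V k r - W k r))
          ≈⟨ *-congˡ (*-congˡ (+-cong (*-congˡ (V-closed k≤m r)) (-‿cong (W-closed k≤m r)))) ⟩
        pow qinv (size (board k)) * (F * (M * (Q * δ₀) - Q * (qint k * (δ₀ - δ₁))))
          ≡⟨ ≡.cong (λ s → pow qinv s * (F * (M * (Q * δ₀) - Q * (qint k * (δ₀ - δ₁)))))
                    (size-rectangle w k (suc n′ ∸ k)) ⟩
        pow qinv (k ℕ.* w) * (F * (M * (Q * δ₀) - Q * (qint k * (δ₀ - δ₁))))
          ≈⟨ solve 7 (λ Q⁻¹ Q F M K δ₀ δ₁ → Q⁻¹ :* (F :* (M :* (Q :* δ₀) :- Q :* (K :* (δ₀ :- δ₁))))
                                        := (Q⁻¹ :* Q) :* (F :* (M :* δ₀ :- K :* (δ₀ :- δ₁))))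
               refl (pow qinv (k ℕ.* w)) Q F M (qint k) δ₀ δ₁ ⟩
        (pow qinv (k ℕ.* w) * Q) * (F * (M * δ₀ - qint k * (δ₀ - δ₁)))
          ≈⟨ *-cong (pow-inverse q*qinv≈1 (k ℕ.* w)) (*-congˡ (+-congʳ (*-congʳ (qint-split k≤m)))) ⟩
        1# * (F * ((qint k + pow q k * qint (suc w ∸ k)) * δ₀ - qint k * (δ₀ - δ₁)))
          ≈⟨ solve 6 (λ F K b t δ₀ δ₁ → :1 :* (F :* ((K :+ b :* t) :* δ₀ :- K :* (δ₀ :- δ₁)))
                                       := F :* (b :* t :* δ₀ :+ K :* δ₁))
               refl F (qint k) (pow q k) (qint (suc w ∸ k)) δ₀ δ₁ ⟩
        F * (pow q k * qint (suc w ∸ k) * δ₀ + qint k * δ₁) ∎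
        where
        k≤m : k ≤ suc w
        k≤m = ℕ.≤-trans k≤n (s≤s n′≤w)
        F M Q δ₀ δ₁ : Carrier
        F  = qfall w n′
        M  = qint (suc w)
        Q  = pow q (k ℕ.* w)
        δ₀ = monomial k r
        δ₁ = monomial k (suc r)
        v : ℕ → Carrier
        v i = σ i * pochCoeff i r

      H-rectangle : ∀ {k} → k ≤ suc n′ → ∀ r →
        H (suc w) (suc n′) (board k) (+ r) ≈
        qfall w n′ * (pow q k * qint (suc w ∸ k) * monomial k r + qint k * monomial k (suc r))
      H-rectangle {k} k≤n r with suc n′ <ᵇ r in n<ᵇr
      ... | false = coeff-hitPoly-rectangle k≤n r
      ... | true  = sym (begin
        qfall w n′ * (pow q k * qint (suc w ∸ k) * monomial k r + qint k * monomial k (suc r))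
          ≈⟨ *-congˡ (+-cong (*-congˡ (monomial-off (ℕ.>⇒≢ k<r)))
                             (*-congˡ (monomial-off (ℕ.>⇒≢ (ℕ.m<n⇒m<1+n k<r))))) ⟩
        qfall w n′ * (pow q k * qint (suc w ∸ k) * 0# + qint k * 0#)
          ≈⟨ solve 3 (λ F X K → F :* (X :* :0 :+ K :* :0) := :0) refl (qfall w n′) (pow q k * qint (suc w ∸ k)) (qint k) ⟩
        0# ∎)
        where
        k<r : k < r
        k<r = ℕ.≤-<-trans k≤n (<ᵇ≡true⇒< n<ᵇr)

      H-rectangle-at : ∀ {k} → k ≤ suc n′ → ∀ r {a b} → monomial k r ≈ a → monomial k (suc r) ≈ b →
        H (suc w) (suc n′) (board k) (+ r) ≈ qfall w n′ * (pow q k * qint (suc w ∸ k) * a + qint k * b)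
      H-rectangle-at k≤n r δ₀≈a δ₁≈b =
        trans (H-rectangle k≤n r) (*-congˡ (+-cong (*-congˡ δ₀≈a) (*-congˡ δ₁≈b)))

      H-at-k : ∀ {k} → k ≤ suc n′ → H (suc w) (suc n′) (board k) (+ k) ≈ pow q k * qint (suc w ∸ k) * qfall w n′
      H-at-k {k} k≤n = trans (H-rectangle-at k≤n k (monomial-diagonal k) (monomial-off {k} {suc k} ℕ.1+n≢n))
        (solve 3 (λ F X K → F :* (X :* :1 :+ K :* :0) := X :* F) refl (qfall w n′) (pow q k * qint (suc w ∸ k)) (qint k))

      -- for k = 0 the index k - 1 is negative, where H vanishes by definition, as does [0]
      H-below-k : ∀ {k} → k ≤ suc n′ → H (suc w) (suc n′) (board k) (+ k -ℤ + 1) ≈ qint k * qfall w n′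
      H-below-k {zero}  _   = sym (zeroˡ _)
      H-below-k {suc j} k≤n =
        trans (H-rectangle-at k≤n j (monomial-off {suc j} {j} (ℕ.1+n≢n ∘ ≡.sym)) (monomial-diagonal (suc j)))
          (solve 3 (λ F X K → F :* (X :* :0 :+ K :* :1) := K :* F) refl
             (qfall w n′) (pow q (suc j) * qint (suc w ∸ suc j)) (qint (suc j)))

      H-elsewhere : ∀ {k} → k ≤ suc n′ → ∀ r → r ≢ + k → r ≢ + k -ℤ + 1 → H (suc w) (suc n′) (board k) r ≈ 0#
      H-elsewhere _           -[1+ _ ] _   _     = refl
      H-elsewhere {k} k≤n (+ j)    j≢k j≢k-1 =
        trans (H-rectangle-at k≤n j (monomial-off (j≢k ∘ ≡.cong (λ t → + t)))
                                    (monomial-off {k} {suc j} (j≢k-1 ∘ ≡.cong (λ t → + t -ℤ + 1))))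
          (solve 3 (λ F X K → F :* (X :* :0 :+ K :* :0) := :0) refl (qfall w n′) (pow q k * qint (suc w ∸ k)) (qint k))

proposition2p17 : ∀ {c ℓ} (R : CommutativeRing c ℓ) (q qinv : CommutativeRing.Carrier R) →
  CommutativeRing._≈_ R (CommutativeRing._*_ R q qinv) (CommutativeRing.1# R) →
  (m n k : ℕ) → 1 ≤ n → n ≤ m → k ≤ n →
  let open QCalc R q qinv
      λk = rectBoard n m k
  in (H m n λk (+ k) ≈ pow q k * qint (m Data.Nat.∸ k) * qfall (m Data.Nat.∸ 1) (n Data.Nat.∸ 1))
     × (H m n λk (+ k -ℤ + 1) ≈ qint k * qfall (m Data.Nat.∸ 1) (n Data.Nat.∸ 1))
     × ((r : ℤ) → r ≢ + k → r ≢ + k -ℤ + 1 → H m n λk r ≈ 0#)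
proposition2p17 R q qinv q*qinv≈1 (suc w) (suc n′) k (s≤s z≤n) (s≤s n′≤w) k≤n =
  H-at-k k≤n , H-below-k k≤n , H-elsewhere k≤n
  where open HitNumbers.Rectangle.HitPolynomial R q qinv w q*qinv≈1 n′≤w
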